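{- Let $W^*$ be the set of increasing functions in $\omega^\omega$, and for $x\in W^*$, $y\in\omega^\omega$ let $x\leq^+y$ iff $x(k+1)\leq y(x(k))$ for all but finitely many $k$. Then the relational system $\mathbf{D}:=\langle W^*,\omega^\omega,\leq^+\rangle$ is Tukey equivalent to $\langle\omega^\omega,\omega^\omega,\leq^*\rangle$.
   Context: A relational system is a triple $\langle X,Y,\sqsubset\rangle$; $\langle X,Y,\sqsubset\rangle\preceq_{\mathrm{T}}\langle X',Y',\sqsubset'\rangle$ means there are $\Psi_-:X\to X'$, $\Psi_+:Y'\to Y$ with $\Psi_-(x)\sqsubset'y'\Rightarrow x\sqsubset\Psi_+(y')$; Tukey equivalent means $\preceq_{\mathrm{T}}$ in both directions. $x\leq^*y$ means $x(n)\leq y(n)$ for all but finitely many $n$. -}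

module Defs where

open import Level using (Level; suc; _⊔_)
open import Data.Nat using (ℕ; _≤_; _<_)
open import Data.Product using (Σ; proj₁; _×_; ∃-syntax)

Baire : Set
Baire = ℕ → ℕ

Eventually : (ℕ → Set) → Set
Eventually P = ∃[ m ] (∀ n → m ≤ n → P n)

_≤*_ : Baire → Baire → Set
x ≤* y = Eventually (λ n → x n ≤ y n)

Increasing : Baire → Set
Increasing x = ∀ n → x n < x (Data.Nat.suc n)

W* : Set
W* = Σ Baire Increasing

_≤⁺_ : W* → Baire → Set
x ≤⁺ y = Eventually (λ k → proj₁ x (Data.Nat.suc k) ≤ y (proj₁ x k))

record RelSys : Set₁ where
  constructor ⟨_,_,_⟩
  field
    X : Set
    Y : Set
    R : X → Y → Set

open RelSys public

_≼T_ : RelSys → RelSys → Set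
A ≼T B = Σ (X A → X B) λ Ψ₋ → Σ (Y B → Y A) λ Ψ₊ →
           ∀ (x : X A) (y' : Y B) → R B (Ψ₋ x) y' → R A x (Ψ₊ y')

_≡T_ : RelSys → RelSys → Set
A ≡T B = (A ≼T B) × (B ≼T A)

𝐃 : RelSys
𝐃 = ⟨ W* , Baire , _≤⁺_ ⟩

𝔇 : RelSys
𝔇 = ⟨ Baire , Baire , _≤*_ ⟩

module Submission where

-- For D ≼T 𝔇, x is sent to its shift x ∘ suc: since x k ≥ k, eventually
-- x (k+1) ≤ x (x k + 1) ≤ y (x k).  For 𝔇 ≼T D, f is sent to an increasing
-- x_f with x_f (k+1) dominating f on [0, x_f k].  If x_f ≤⁺ y, every n in a
-- late block [x_f k, x_f (k+1)) satisfies
-- f n ≤ x_f (k+2) ≤ y (x_f (k+1)) ≤ y (y (x_f k)), and replacing y by its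
-- monotone majorant y⁺ bounds this by y⁺ (y⁺ n), which no longer depends on f.

open import Defs
open import Data.Nat
open import Data.Nat.Properties
open import Data.Product using (_,_; proj₁; ∃-syntax; _×_)
open import Data.Sum using (inj₁; inj₂)
open import Function using (_∘_; id)
open import Relation.Binary.PropositionalEquality using (sym; subst)
open import Relation.Nullary using (yes; no; contradiction)

module _ {x : Baire} (x-inc : Increasing x) where

  Increasing⇒monotone : ∀ {i j} → i ≤ j → x i ≤ x j
  Increasing⇒monotone = go ∘ ≤⇒≤′
    where
    go : ∀ {i j} → i ≤′ j → x i ≤ x j
    go ≤′-refl       = ≤-refl
    go (≤′-step i≤j) = ≤-trans (go i≤j) (<⇒≤ (x-inc _))

  Increasing⇒inflationary : ∀ k → k ≤ x k
  Increasing⇒inflationary zero    = z≤n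
  Increasing⇒inflationary (suc k) = ≤-<-trans (Increasing⇒inflationary k) (x-inc k)

  Increasing⇒reflects-< : ∀ {i j} → x i < x j → i < j
  Increasing⇒reflects-< {i} {j} xi<xj with i <? j
  ... | yes i<j = i<j
  ... | no  i≮j = contradiction (Increasing⇒monotone (≮⇒≥ i≮j)) (<⇒≱ xi<xj)

  Increasing⇒block : ∀ {n} → x zero ≤ n → ∃[ k ] (x k ≤ n × n < x (suc k))
  Increasing⇒block {zero} x0≤0 = zero , x0≤0 , ≤-<-trans z≤n (x-inc zero)
  Increasing⇒block {suc n} x0≤1+n with m≤n⇒m<n∨m≡n x0≤1+n
  ... | inj₂ x0≡1+n = zero , x0≤1+n , subst (_< x 1) x0≡1+n (x-inc zero)
  ... | inj₁ x0≤n with Increasing⇒block (≤-pred x0≤n)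
  ...   | k , xk≤n , n<xk+1 with m≤n⇒m<n∨m≡n n<xk+1
  ...     | inj₁ 1+n<xk+1 = k , m≤n⇒m≤1+n xk≤n , 1+n<xk+1
  ...     | inj₂ 1+n≡xk+1 =
    suc k , ≤-reflexive (sym 1+n≡xk+1) , subst (_< x (2 + k)) (sym 1+n≡xk+1) (x-inc (suc k))

runningSum : Baire → Baire
runningSum g zero    = g zero
runningSum g (suc n) = g (suc n) + runningSum g n

≤-runningSum : ∀ g n → g n ≤ runningSum g n
≤-runningSum g zero    = ≤-refl
≤-runningSum g (suc n) = m≤m+n _ _

runningSum-mono : ∀ g {i j} → i ≤ j → runningSum g i ≤ runningSum g j
runningSum-mono g = go ∘ ≤⇒≤′
  where
  go : ∀ {i j} → i ≤′ j → runningSum g i ≤ runningSum g j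
  go ≤′-refl       = ≤-refl
  go (≤′-step i≤j) = ≤-trans (go i≤j) (m≤n+m _ _)

runningSum-dominates : ∀ g {i n} → i ≤ n → g i ≤ runningSum g n
runningSum-dominates g {i} i≤n = ≤-trans (≤-runningSum g i) (runningSum-mono g i≤n)

shift : W* → Baire
shift x = proj₁ x ∘ suc

shift-≤*⇒≤⁺ : (x : W*) (y : Baire) → shift x ≤* y → x ≤⁺ y
shift-≤*⇒≤⁺ (x , x-inc) y (m , x∘suc≤y) = m , λ k m≤k →
  let k≤xk = Increasing⇒inflationary x-inc k in
  ≤-trans (Increasing⇒monotone x-inc (s≤s k≤xk)) (x∘suc≤y (x k) (≤-trans m≤k k≤xk))

outgrow : Baire → Baire
outgrow f zero    = zero
outgrow f (suc j) = suc (outgrow f j + runningSum f (outgrow f j))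

outgrow-increasing : ∀ f → Increasing (outgrow f)
outgrow-increasing f j = s≤s (m≤m+n _ _)

outgrow-dominates : ∀ f {i} j → i ≤ outgrow f j → f i ≤ outgrow f (suc j)
outgrow-dominates f j i≤xj =
  ≤-trans (runningSum-dominates f i≤xj) (≤-trans (m≤n+m _ _) (n≤1+n _))

≤⁺-outgrow⇒≤* : ∀ f y → (outgrow f , outgrow-increasing f) ≤⁺ y →
                f ≤* (runningSum y ∘ runningSum y)
≤⁺-outgrow⇒≤* f y (m , x≤⁺y) = x m , bound
  where
  x : Baire
  x = outgrow f
  x-inc : Increasing x
  x-inc = outgrow-increasing f
  y⁺ : Baire
  y⁺ = runningSum y

  bound : ∀ n → x m ≤ n → f n ≤ y⁺ (y⁺ n)
  bound n xm≤n with Increasing⇒block x-inc {n} z≤n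
  ... | k , xk≤n , n<xk+1 = begin
    f n            ≤⟨ outgrow-dominates f (suc k) (<⇒≤ n<xk+1) ⟩
    x (2 + k)      ≤⟨ x≤⁺y (suc k) (m≤n⇒m≤1+n m≤k) ⟩
    y (x (1 + k))  ≤⟨ ≤-runningSum y _ ⟩
    y⁺ (x (1 + k)) ≤⟨ runningSum-mono y xk+1≤y⁺n ⟩
    y⁺ (y⁺ n)      ∎
    where
    open ≤-Reasoning
    m≤k : m ≤ k
    m≤k = ≤-pred (Increasing⇒reflects-< x-inc (≤-<-trans xm≤n n<xk+1))
    xk+1≤y⁺n : x (1 + k) ≤ y⁺ n
    xk+1≤y⁺n = ≤-trans (x≤⁺y k m≤k) (runningSum-dominates y xk≤n)

lemma5p7 : 𝐃 ≡T 𝔇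
lemma5p7 = (shift , id , shift-≤*⇒≤⁺)
         , (λ f → outgrow f , outgrow-increasing f)
         , (λ y → runningSum y ∘ runningSum y)
         , ≤⁺-outgrow⇒≤*
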